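{- Let $X$ be a Rado complex and let $Y$ be obtained from $X$ by selecting a finite set $F$ of simplexes of $X$ and deleting all simplexes of $X$ which contain a simplex from $F$ as a face (including the simplexes of $F$ themselves). Then $Y$ is also a Rado complex.
   Context: For $U\subseteq V(X)$, $X_U$ denotes the induced subcomplex on $U$; $\mathrm{Lk}_X(v)$ is the subcomplex of simplexes $\sigma$ with $v\notin\sigma$ and $\sigma\cup\{v\}\in X$. A Rado complex is a simplicial complex with a countable vertex set which is $\infty$-ample: it is nonempty and for every finite $U\subseteq V(X)$ and every subcomplex $A\subseteq X_U$ (possibly empty) there exists $v\in V(X)\setminus U$ with $\mathrm{Lk}_X(v)\cap X_U=A$. -}

module Defs where

open import Data.Nat using (ℕ)
open import Data.List using (List; []; _∷_; [_])
open import Data.List.Membership.Propositional using (_∈_; _∉_)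
open import Data.List.Relation.Binary.Subset.Propositional using (_⊆_)
open import Data.List.Relation.Unary.All using (All)
open import Data.Product using (_×_; ∃)
open import Relation.Nullary using (¬_)
open import Relation.Binary.PropositionalEquality using (_≢_)
open import Function.Bundles using (_⇔_)

-- Vertices are natural numbers (so every vertex set is countable).
-- A simplex is a finite nonempty set of vertices, represented by a list
-- (only its set of elements matters; closure under subsets makes every
-- complex extensional in this sense).
Cx : Set₁
Cx = List ℕ → Set

IsComplex : Cx → Set
IsComplex X = (¬ X []) × (∀ σ τ → X σ → τ ≢ [] → τ ⊆ σ → X τ)

Vertex : Cx → ℕ → Set
Vertex X v = X [ v ]

Induced : Cx → List ℕ → Cx
Induced X U σ = X σ × σ ⊆ U

IsSubcomplex : Cx → Cx → Set
IsSubcomplex A B = IsComplex A × (∀ σ → A σ → B σ)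

Link : Cx → ℕ → Cx
Link X v σ = v ∉ σ × X (v ∷ σ)

-- ∞-ample (without the nonemptiness clause)
Ample : Cx → Set₁
Ample X = ∀ (U : List ℕ) → All (Vertex X) U →
          ∀ (A : Cx) → IsSubcomplex A (Induced X U) →
          ∃ λ v → Vertex X v × v ∉ U ×
            (∀ σ → (Link X v σ × Induced X U σ) ⇔ A σ)

Rado : Cx → Set₁
Rado X = IsComplex X × (∃ λ v → Vertex X v) × Ample X

Delete : Cx → List (List ℕ) → Cx
Delete X F σ = X σ × All (λ f → ¬ (f ⊆ σ)) F

module Submission where

open import Defs
open import Data.Nat using (ℕ)
open import Data.List using (List; []; _∷_; [_]; _++_; concat)
open import Data.List.Relation.Unary.All using (All)
import Data.List.Relation.Unary.All as All
open import Data.List.Relation.Unary.All.Properties using (++⁺; concat⁺; ¬Any⇒All¬)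
open import Data.List.Relation.Unary.Any using (here; there)
open import Data.List.Membership.Propositional using (_∉_)
open import Data.List.Membership.Propositional.Properties using (∈-++⁺ˡ; ∈-++⁺ʳ; ∈-concat⁺)
open import Data.List.Relation.Binary.Subset.Propositional using (_⊆_)
open import Data.List.Relation.Binary.Subset.Propositional.Properties using (⊆[]⇒≡[])
open import Data.Product using (_×_; ∃; _,_; proj₁; proj₂)
open import Data.Empty using (⊥; ⊥-elim)
open import Relation.Nullary using (¬_)
open import Relation.Binary.PropositionalEquality using (refl; subst)
open import Function using (_∘_)
open import Function.Bundles using (_⇔_; mk⇔; Equivalence)

-- Idea: given finite U ⊆ V(Y) and A ⊆ Y_U, apply ampleness of X to the larger
-- finite set W = U ∪ ⋃F.  The vertex v it produces lies outside every simplex of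
-- F, so a simplex of F can be a face of v ∪ σ only if it is a face of σ; hence
-- adjoining v to a simplex of Y never creates a deleted simplex, and the link of
-- v in Y cuts out exactly A on Y_U.

module _ {X : Cx} (isComplex : IsComplex X) where

  simplex-vertices : ∀ {σ} → X σ → All (Vertex X) σ
  simplex-vertices {σ} Xσ =
    All.tabulate λ {x} x∈σ → proj₂ isComplex σ [ x ] Xσ (λ ()) λ { (here refl) → x∈σ }

  simplex-⊈-[] : ∀ {σ} → X σ → ¬ σ ⊆ []
  simplex-⊈-[] Xσ σ⊆[] = proj₁ isComplex (subst X (⊆[]⇒≡[] σ⊆[]) Xσ)

Delete-isComplex : ∀ {X} F → IsComplex X → IsComplex (Delete X F)
Delete-isComplex F (¬X[] , X-faces) =
    ¬X[] ∘ proj₁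
  , λ σ τ (Xσ , σ-avoids) τ≢[] τ⊆σ →
      X-faces σ τ Xσ τ≢[] τ⊆σ , All.map (λ f⊈σ f⊆τ → f⊈σ (λ x∈f → τ⊆σ (f⊆τ x∈f))) σ-avoids

∉-concat⇒All∉ : ∀ {v : ℕ} (F : List (List ℕ)) → v ∉ concat F → All (v ∉_) F
∉-concat⇒All∉ F v∉⋃F = ¬Any⇒All¬ F (v∉⋃F ∘ ∈-concat⁺)

⊆-cons⁻ : ∀ {v : ℕ} {f σ} → v ∉ f → f ⊆ v ∷ σ → f ⊆ σ
⊆-cons⁻ v∉f f⊆vσ x∈f with f⊆vσ x∈f
... | here refl = ⊥-elim (v∉f x∈f)
... | there x∈σ = x∈σ

Delete-cons : ∀ {X F v σ} → All (v ∉_) F → X (v ∷ σ) →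
  All (λ f → ¬ f ⊆ σ) F → Delete X F (v ∷ σ)
Delete-cons v∉F Xvσ σ-avoids =
  Xvσ , All.zipWith (λ (v∉f , f⊈σ) → f⊈σ ∘ ⊆-cons⁻ v∉f) (v∉F , σ-avoids)

Delete-vertex : ∀ {X F v} → IsComplex X → All X F → All (v ∉_) F →
  Vertex X v → Vertex (Delete X F) v
Delete-vertex {X} isComplex XF v∉F Xv =
  Delete-cons {X} v∉F Xv (All.map (simplex-⊈-[] isComplex) XF)

Delete-Induced⊆Induced-++⋃ : ∀ {X} F U σ → Induced (Delete X F) U σ → Induced X (U ++ concat F) σ
Delete-Induced⊆Induced-++⋃ F U σ ((Xσ , _) , σ⊆U) = Xσ , λ x∈σ → ∈-++⁺ˡ (σ⊆U x∈σ)

Delete-link-cuts : ∀ {X} F → IsComplex X → All X F → ∀ {U : List ℕ} {A : Cx} {v : ℕ} →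
  (∀ σ → A σ → Induced (Delete X F) U σ) →
  Vertex X v → v ∉ U ++ concat F →
  (∀ σ → (Link X v σ × Induced X (U ++ concat F) σ) ⇔ A σ) →
  Vertex (Delete X F) v × v ∉ U ×
  (∀ σ → (Link (Delete X F) v σ × Induced (Delete X F) U σ) ⇔ A σ)
Delete-link-cuts {X} F isComplex XF {U} {A} {v} A⊆Y[U] Xv v∉W link-cuts-A =
  Delete-vertex isComplex XF v∉F Xv , (λ v∈U → v∉W (∈-++⁺ˡ v∈U)) , λ σ → mk⇔ (to σ) (from σ)
  where
  v∉F : All (v ∉_) F
  v∉F = ∉-concat⇒All∉ F (λ v∈⋃F → v∉W (∈-++⁺ʳ U v∈⋃F))

  to : ∀ σ → Link (Delete X F) v σ × Induced (Delete X F) U σ → A σ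
  to σ ((v∉σ , (Xvσ , _)) , Y[U]σ) =
    Equivalence.to (link-cuts-A σ) ((v∉σ , Xvσ) , Delete-Induced⊆Induced-++⋃ {X} F U σ Y[U]σ)

  from : ∀ σ → A σ → Link (Delete X F) v σ × Induced (Delete X F) U σ
  from σ Aσ =
    let (v∉σ , Xvσ) , _ = Equivalence.from (link-cuts-A σ) Aσ
        Y[U]σ@((_ , σ-avoids) , _) = A⊆Y[U] σ Aσ
    in (v∉σ , Delete-cons {X} v∉F Xvσ σ-avoids) , Y[U]σ

Delete-ample : ∀ {X} F → IsComplex X → All X F → Ample X → Ample (Delete X F)
Delete-ample {X} F isComplex XF ample U U-vertices A (isComplexA , A⊆Y[U]) =
  let v , Xv , v∉W , link-cuts-A = ample (U ++ concat F) W-vertices A (isComplexA , A⊆X[W])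
  in v , Delete-link-cuts F isComplex XF A⊆Y[U] Xv v∉W link-cuts-A
  where
  W-vertices : All (Vertex X) (U ++ concat F)
  W-vertices = ++⁺ (All.map proj₁ U-vertices)
                   (concat⁺ (All.map (simplex-vertices isComplex) XF))

  A⊆X[W] : ∀ σ → A σ → Induced X (U ++ concat F) σ
  A⊆X[W] σ Aσ = Delete-Induced⊆Induced-++⋃ {X} F U σ (A⊆Y[U] σ Aσ)

ample⇒vertex : ∀ {X} → Ample X → ∃ (Vertex X)
ample⇒vertex ample
  with ample [] All.[] (λ _ → ⊥) (((λ ()) , (λ _ _ ())) , (λ _ ()))
... | v , Xv , _ = v , Xv

corollary10p2 : (X : Cx) → Rado X → (F : List (List ℕ)) → All X F →
    Rado (Delete X F)
corollary10p2 X (isComplex , _ , ample) F XF =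
  Delete-isComplex F isComplex , ample⇒vertex ampleY , ampleY
  where
  ampleY : Ample (Delete X F)
  ampleY = Delete-ample F isComplex XF ample
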